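{- Let $G=(V,E)$ be a connected graph with a weight function $w:V\to\mathbb{N}^+$, let $C\subseteq V$ be a maximum-weight vertex set such that $G[C]$ is a 2-club, and let $D$ be a minimum-weight vertex cut set of $G$. Then every 2-club vertex deletion set $S$ of $G$ satisfies $w(S)\ge\min(w(V\setminus C),w(D))$.
   Context: All graphs are finite, simple and undirected. A 2-club is a graph of diameter at most two; a 2-club cluster graph is a graph each of whose connected components is a 2-club. A 2-club vertex deletion set of $G$ is a set $S\subseteq V$ such that $G[V\setminus S]$ is a 2-club cluster graph. A vertex cut set of $G$ is a set $D\subseteq V$ such that $G-D$ is disconnected. For $X\subseteq V$, $w(X)=\sum_{v\in X}w(v)$. -}

module Defs where

open import Data.Nat using (ℕ; _≤_; _<_; _⊓_)
open import Data.Fin using (Fin)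
open import Data.Fin.Subset using (Subset; _∈_; _∉_; ∁; outside; inside)
open import Data.Vec using (lookup; tabulate; sum)
open import Data.Bool using (if_then_else_)
open import Data.Product using (Σ; _×_; ∃; ∃-syntax)
open import Data.Sum using (_⊎_)
open import Relation.Nullary using (¬_)
open import Relation.Binary.PropositionalEquality using (_≡_)

record Graph (n : ℕ) : Set₁ where
  field
    Adj    : Fin n → Fin n → Set
    symm   : ∀ {u v} → Adj u v → Adj v u
    irrefl : ∀ {u} → ¬ Adj u u

module _ {n : ℕ} (G : Graph n) where
  open Graph G

  data Reach (X : Subset n) : Fin n → Fin n → Set where
    here : ∀ {u} → u ∈ X → Reach X u u
    step : ∀ {u w v} → u ∈ X → Adj u w → Reach X w v → Reach X u v

  Connected : Subset n → Set
  Connected X = ∀ u v → u ∈ X → v ∈ X → Reach X u v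

  Dist≤2 : Subset n → Fin n → Fin n → Set
  Dist≤2 X u v = u ≡ v ⊎ Adj u v ⊎ (∃[ w ] (w ∈ X × Adj u w × Adj w v))

  IsTwoClub : Subset n → Set
  IsTwoClub X = ∀ u v → u ∈ X → v ∈ X → Dist≤2 X u v

  IsTwoClubCluster : Subset n → Set
  IsTwoClubCluster X = ∀ u v → u ∈ X → v ∈ X → Reach X u v → Dist≤2 X u v

  IsTwoClubDeletionSet : Subset n → Set
  IsTwoClubDeletionSet S = IsTwoClubCluster (∁ S)

  IsVertexCut : Subset n → Set
  IsVertexCut D = ∃[ u ] ∃[ v ] (u ∉ D × v ∉ D × ¬ Reach (∁ D) u v)

weight : ∀ {n} → (Fin n → ℕ) → Subset n → ℕ
weight w X = sum (tabulate λ i → if lookup X i then w i else 0)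

-- If w(S) < w(D), then S is not a vertex cut, so G − S is connected; a connected
-- 2-club cluster graph is a 2-club, so maximality of C gives w(V∖S) ≤ w(C), which
-- is w(V∖C) ≤ w(S) after subtracting both sides from w(V).
module Submission where

open import Defs
open import Data.Nat using (ℕ; zero; suc; _≤_; _<_; _⊓_; _+_; _≤?_)
open import Data.Nat.Properties using (m⊓n≤m; m⊓n≤n; ≤-trans; +-cancelˡ-≤; +-monoʳ-≤; +-comm; +-assoc; +-commutativeSemigroup; module ≤-Reasoning)
open import Algebra.Properties.CommutativeSemigroup +-commutativeSemigroup using (x∙yz≈y∙xz)
open import Data.Fin using (Fin; zero; suc)
open import Data.Fin.Subset using (Subset; ∁; ⊤; _∈_)
open import Data.Fin.Subset.Properties using (x∈∁p⇒x∉p)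
open import Data.Vec using (_∷_; []; tabulate; sum)
open import Data.Bool using (true; false)
open import Data.Product using (_,_)
open import Data.Empty using (⊥-elim)
open import Function using (_∘_)
open import Relation.Nullary using (¬_; Dec; yes; no)
open import Relation.Nullary.Negation using (DoubleNegation; ¬¬-map)
open import Relation.Nullary.Decidable using (decidable-stable; ¬¬-excluded-middle)
open import Relation.Binary.PropositionalEquality using (_≡_; refl; trans; cong)

weight+weight-∁≡sum : ∀ {n} (w : Fin n → ℕ) (X : Subset n) →
                      weight w X + weight w (∁ X) ≡ sum (tabulate w)
weight+weight-∁≡sum w [] = refl
weight+weight-∁≡sum w (true ∷ X) =
  trans (+-assoc (w zero) _ _) (cong (w zero +_) (weight+weight-∁≡sum (w ∘ suc) X))
weight+weight-∁≡sum w (false ∷ X) =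
  trans (x∙yz≈y∙xz (weight (w ∘ suc) X) (w zero) _) (cong (w zero +_) (weight+weight-∁≡sum (w ∘ suc) X))

weight-∁-≤-swap : ∀ {n} (w : Fin n → ℕ) (A B : Subset n) →
                  weight w (∁ A) ≤ weight w B → weight w (∁ B) ≤ weight w A
weight-∁-≤-swap w A B ∁A≤B = +-cancelˡ-≤ (weight w B) _ _ (begin
  weight w B + weight w (∁ B)  ≡⟨ weight+weight-∁≡sum w B ⟩
  sum (tabulate w)             ≡⟨ weight+weight-∁≡sum w A ⟨
  weight w A + weight w (∁ A)  ≤⟨ +-monoʳ-≤ (weight w A) ∁A≤B ⟩
  weight w A + weight w B      ≡⟨ +-comm (weight w A) (weight w B) ⟩
  weight w B + weight w A      ∎)
  where open ≤-Reasoning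

¬¬-∀-Fin : ∀ {n} {P : Fin n → Set} → (∀ i → DoubleNegation (P i)) → DoubleNegation (∀ i → P i)
¬¬-∀-Fin {zero}  ¬¬P ¬∀P = ¬∀P λ ()
¬¬-∀-Fin {suc n} ¬¬P ¬∀P = ¬¬P zero λ P₀ → ¬¬-∀-Fin (¬¬P ∘ suc) λ P₊ →
  ¬∀P λ { zero → P₀ ; (suc i) → P₊ i }

module _ {n : ℕ} (G : Graph n) where

  -- Reachability is undecidable for an abstract adjacency relation, so
  -- connectivity of G − S is only obtained up to double negation.
  ¬IsVertexCut⇒¬¬Connected : (S : Subset n) → ¬ IsVertexCut G S → DoubleNegation (Connected G (∁ S))
  ¬IsVertexCut⇒¬¬Connected S ¬cut = ¬¬-∀-Fin λ u → ¬¬-∀-Fin λ v → ¬¬-map (reach u v) ¬¬-excluded-middle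
    where
    reach : ∀ u v → Dec (Reach G (∁ S) u v) → u ∈ ∁ S → v ∈ ∁ S → Reach G (∁ S) u v
    reach u v (yes u⇝v) _    _    = u⇝v
    reach u v (no u⇸v)  u∈∁S v∈∁S = ⊥-elim (¬cut (u , v , x∈∁p⇒x∉p u∈∁S , x∈∁p⇒x∉p v∈∁S , u⇸v))

  connected∧cluster⇒twoClub : ∀ {X} → IsTwoClubCluster G X → Connected G X → IsTwoClub G X
  connected∧cluster⇒twoClub cluster conn u v u∈X v∈X = cluster u v u∈X v∈X (conn u v u∈X v∈X)

mainTheorem9 : ∀ {n : ℕ} (G : Graph n) (w : Fin n → ℕ)
    → Connected G ⊤
    → (∀ v → 0 < w v)
    → (C : Subset n) → IsTwoClub G C → (∀ C′ → IsTwoClub G C′ → weight w C′ ≤ weight w C)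
    → (D : Subset n) → IsVertexCut G D → (∀ D′ → IsVertexCut G D′ → weight w D ≤ weight w D′)
    → (S : Subset n) → IsTwoClubDeletionSet G S
    → weight w (∁ C) ⊓ weight w D ≤ weight w S
mainTheorem9 G w _ _ C _ maxC D _ minD S deletion with weight w D ≤? weight w S
... | yes D≤S = ≤-trans (m⊓n≤n _ _) D≤S
... | no D≰S  = ≤-trans (m⊓n≤m _ _)
                  (decidable-stable (_ ≤? _) (¬¬-map ∁C≤S (¬IsVertexCut⇒¬¬Connected G S (D≰S ∘ minD S))))
  where
  ∁C≤S : Connected G (∁ S) → weight w (∁ C) ≤ weight w S
  ∁C≤S conn = weight-∁-≤-swap w S C (maxC (∁ S) (connected∧cluster⇒twoClub G deletion conn))
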